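{- Let $A$ be an $n\times n$ matrix over a field $\mathbb{F}$ with all off-diagonal entries nonzero. Let $S\subseteq[n]$ be a cut of $A$, let $t\in S$, and suppose $X\subseteq\overline S$ is a cut of $A[\overline S\cup\{t\}]$. Then $X$ is a cut of $A$.
   Context: $\overline S=[n]\setminus S$; $A[P,Q]$ is the submatrix with rows $P$, columns $Q$, $A[P]=A[P,P]$. For a matrix $M$ indexed by a set $I$ with $|I|\ge4$, $X\subset I$ is a cut of $M$ if $2\le|X|\le|I|-2$ and $M[X,I\setminus X]$, $M[I\setminus X,X]$ have rank at most one. -}

module Defs where

open import Level using (Level; _⊔_; suc)
open import Data.Nat using (ℕ; _≤_; _∸_)
open import Data.Fin using (Fin)
open import Data.Fin.Subset using (Subset; _∈_; _∉_; _⊆_; ∣_∣)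
open import Data.Product using (Σ; ∃; _×_)
open import Relation.Nullary using (¬_)
open import Algebra.Bundles using (CommutativeRing)

record Field (c ℓ : Level) : Set (Level.suc (c ⊔ ℓ)) where
  field
    commutativeRing : CommutativeRing c ℓ
  open CommutativeRing commutativeRing public
  field
    0≉1     : ¬ (0# ≈ 1#)
    inverse : ∀ x → ¬ (x ≈ 0#) → Σ Carrier (λ y → x * y ≈ 1#)

module _ {c ℓ : Level} (F : Field c ℓ) where
  open Field F

  Matrix : ℕ → Set c
  Matrix n = Fin n → Fin n → Carrier

  -- The submatrix A[P,Q] (rows P, columns Q) has rank at most one:
  -- its column space is spanned by a single vector u (indexed by rows in P),
  -- i.e. every column j ∈ Q is a scalar multiple of u on the rows of P.
  RankAtMostOne : {n : ℕ} → Matrix n → Subset n → Subset n → Set (c ⊔ ℓ)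
  RankAtMostOne {n} A P Q =
    ∃ λ (u : Fin n → Carrier) →
      ∀ j → j ∈ Q → ∃ λ (λj : Carrier) → ∀ i → i ∈ P → A i j ≈ λj * u i

  IsCut : {n : ℕ} → Matrix n → Subset n → Subset n → Set (c ⊔ ℓ)
  IsCut {n} A I X =
    4 ≤ ∣ I ∣ × X ⊆ I × 2 ≤ ∣ X ∣ × ∣ X ∣ ≤ ∣ I ∣ ∸ 2 ×
    RankAtMostOne A X (I Data.Fin.Subset.─ X) ×
    RankAtMostOne A (I Data.Fin.Subset.─ X) X

-- If one nonzero column of a rank-one block lies in the span of u, all its
-- columns do.  As X ⊆ S̄ and the off-diagonal entries of A are nonzero, A[X,t]
-- is a nonzero column both of the rank-one block A[X,S] and of the rank-one
-- block A[X,(S̄∪{t})∖X].  Hence the columns of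
-- A[X,S] are multiples of the same vector as those of A[X,(S̄∪{t})∖X], and
-- together these are all columns of A[X,X̄].  The block A[X̄,X] follows by
-- applying the same argument to the transpose of A.
module Submission where

open import Defs
open import Level using (Level)
open import Data.Nat using (ℕ; _<_; z≤n; s≤s)
open import Data.Nat.Properties using (≤-trans; ∸-monoˡ-≤)
open import Data.Fin using (Fin)
open import Data.Fin.Subset using (Subset; ⊤; ∁; _∪_; ⁅_⁆; _∈_; _∉_; _⊆_; _─_; ∣_∣; Nonempty; outside; inside)
open import Data.Fin.Subset.Properties
open import Data.Vec using (_∷_; here; there)
open import Data.Product using (∃; _,_; proj₁; proj₂)
open import Data.Sum using (inj₁; inj₂)
open import Function using (_∘_)
open import Relation.Binary.PropositionalEquality using (_≢_; refl; subst)
open import Relation.Nullary using (¬_; yes; no; contradiction)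

private
  variable
    n : ℕ

x∈p─q⇒x∉q : ∀ (p q : Subset n) {x} → x ∈ p ─ q → x ∉ q
x∈p─q⇒x∉q (_       ∷ p) (_      ∷ q) (there x∈p─q) (there x∈q) = x∈p─q⇒x∉q p q x∈p─q x∈q
x∈p─q⇒x∉q (inside  ∷ p) (inside ∷ q) ()            here
x∈p─q⇒x∉q (outside ∷ p) (inside ∷ q) ()            here

0<∣p∣⇒Nonempty : (p : Subset n) → 0 < ∣ p ∣ → Nonempty p
0<∣p∣⇒Nonempty {n} p 0<∣p∣ with nonempty? p
... | yes p-nonempty = p-nonempty
... | no p-empty with Empty-unique p-empty
... | refl with subst (0 <_) (∣⊥∣≡0 n) 0<∣p∣
... | ()

module _ {c ℓ : Level} (F : Field c ℓ) where

  open Field F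
  open import Relation.Binary.Reasoning.Setoid setoid

  transpose : Matrix F n → Matrix F n
  transpose A i j = A j i

  InSpan : Subset n → (Fin n → Carrier) → (Fin n → Carrier) → Set (c Level.⊔ ℓ)
  InSpan P u x = ∃ λ κ → ∀ i → i ∈ P → x i ≈ κ * u i

  -- RankAtMostOne F A P Q unfolds to ∃ (ColumnsSpannedBy A P Q).
  ColumnsSpannedBy : Matrix F n → Subset n → Subset n → (Fin n → Carrier) → Set (c Level.⊔ ℓ)
  ColumnsSpannedBy A P Q u = ∀ j → j ∈ Q → InSpan P u (λ i → A i j)

  a*b≉0⇒a≉0 : ∀ {a b} → ¬ (a * b ≈ 0#) → ¬ (a ≈ 0#)
  a*b≉0⇒a≉0 {a} {b} ab≉0 a≈0 = ab≉0 (begin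
    a * b  ≈⟨ *-congʳ a≈0 ⟩
    0# * b ≈⟨ zeroˡ b ⟩
    0#     ∎)

  *-cancelˡ-≉0 : ∀ {μ} → ¬ (μ ≈ 0#) → ∃ λ w → ∀ {a b} → μ * a ≈ b → a ≈ w * b
  *-cancelˡ-≉0 {μ} μ≉0 with inverse μ μ≉0
  ... | w , μw≈1 = w , λ {a} {b} μa≈b → begin
    a            ≈⟨ *-identityˡ a ⟨
    1# * a       ≈⟨ *-congʳ μw≈1 ⟨
    (μ * w) * a  ≈⟨ *-congʳ (*-comm μ w) ⟩
    (w * μ) * a  ≈⟨ *-assoc w μ a ⟩
    w * (μ * a)  ≈⟨ *-congˡ μa≈b ⟩
    w * b        ∎

  InSpan-⊆ : ∀ {P P′ : Subset n} {u x} → P′ ⊆ P → InSpan P u x → InSpan P′ u x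
  InSpan-⊆ P′⊆P (κ , x≈κu) = κ , λ i i∈P′ → x≈κu i (P′⊆P i∈P′)

  InSpan-trans : ∀ {P : Subset n} {u v x} → InSpan P v x → InSpan P u v → InSpan P u x
  InSpan-trans {u = u} {v} {x} (κ , x≈κv) (ρ , v≈ρu) = κ * ρ , λ i i∈P → begin
    x i           ≈⟨ x≈κv i i∈P ⟩
    κ * v i       ≈⟨ *-congˡ (v≈ρu i i∈P) ⟩
    κ * (ρ * u i) ≈⟨ *-assoc κ ρ (u i) ⟨
    κ * ρ * u i   ∎

  ColumnsSpannedBy-⊆rows : ∀ {A : Matrix F n} {P P′ Q u} → P′ ⊆ P →
                           ColumnsSpannedBy A P Q u → ColumnsSpannedBy A P′ Q u
  ColumnsSpannedBy-⊆rows P′⊆P cols j j∈Q = InSpan-⊆ P′⊆P (cols j j∈Q)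

  ColumnsSpannedBy-∪ : ∀ {A : Matrix F n} {P Q Q₁ Q₂ u} → Q ⊆ Q₁ ∪ Q₂ →
                       ColumnsSpannedBy A P Q₁ u → ColumnsSpannedBy A P Q₂ u →
                       ColumnsSpannedBy A P Q u
  ColumnsSpannedBy-∪ {Q₁ = Q₁} {Q₂} Q⊆Q₁∪Q₂ cols₁ cols₂ j j∈Q
    with x∈p∪q⁻ Q₁ Q₂ (Q⊆Q₁∪Q₂ j∈Q)
  ... | inj₁ j∈Q₁ = cols₁ j j∈Q₁
  ... | inj₂ j∈Q₂ = cols₂ j j∈Q₂

  ColumnsSpannedBy-pivot : ∀ {A : Matrix F n} {P Q u v i t} → i ∈ P → ¬ (A i t ≈ 0#) → t ∈ Q →
                           ColumnsSpannedBy A P Q v → InSpan P u (λ k → A k t) →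
                           ColumnsSpannedBy A P Q u
  ColumnsSpannedBy-pivot {A = A} {P} {v = v} {i} {t} i∈P Ait≉0 t∈Q cols column-t
    with cols _ t∈Q
  ... | μ , column-t≈μv with *-cancelˡ-≉0 (a*b≉0⇒a≉0 (Ait≉0 ∘ trans (column-t≈μv i i∈P)))
  ... | w , cancel = λ j j∈Q → InSpan-trans (cols j j∈Q) (InSpan-trans v∈span column-t)
    where
    v∈span : InSpan P (λ k → A k t) v
    v∈span = w , λ k k∈P → cancel (sym (column-t≈μv k k∈P))

  transpose-RankAtMostOne : ∀ {A : Matrix F n} {P Q} → RankAtMostOne F A P Q →
                            RankAtMostOne F (transpose A) Q P
  transpose-RankAtMostOne {A = A} {P} {Q} (u , cols) = coefficient , λ i i∈P → u i , row i i∈P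
    where
    coefficient : Fin _ → Carrier
    coefficient j with j ∈? Q
    ... | yes j∈Q = proj₁ (cols j j∈Q)
    ... | no _    = 0#

    row : ∀ i → i ∈ P → ∀ j → j ∈ Q → A i j ≈ u i * coefficient j
    row i i∈P j j∈Q with j ∈? Q
    ... | yes j∈Q′ = trans (proj₂ (cols j j∈Q′) i i∈P) (*-comm _ (u i))
    ... | no j∉Q   = contradiction j∈Q j∉Q

  RankAtMostOne-extend : ∀ {A : Matrix F n} {S X : Subset n} {t i} → t ∈ S → X ⊆ ∁ S →
                         i ∈ X → ¬ (A i t ≈ 0#) →
                         RankAtMostOne F A (⊤ ─ S) S →
                         RankAtMostOne F A X ((∁ S ∪ ⁅ t ⁆) ─ X) →
                         RankAtMostOne F A X (⊤ ─ X)
  RankAtMostOne-extend {S = S} {X} {t} t∈S X⊆∁S i∈X Ait≉0 (v , S-cols) (u , X-cols) =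
    u , ColumnsSpannedBy-∪ X̄⊆S∪I─X
          (ColumnsSpannedBy-pivot i∈X Ait≉0 t∈S
            (ColumnsSpannedBy-⊆rows X⊆⊤─S S-cols) (X-cols t t∈I─X))
          X-cols
    where
    X⊆⊤─S : X ⊆ ⊤ ─ S
    X⊆⊤─S k∈X = x∈p∧x∉q⇒x∈p─q ∈⊤ (x∈∁p⇒x∉p (X⊆∁S k∈X))

    t∈I─X : t ∈ (∁ S ∪ ⁅ t ⁆) ─ X
    t∈I─X = x∈p∧x∉q⇒x∈p─q (x∈p∪q⁺ (inj₂ (x∈⁅x⁆ t))) (λ t∈X → x∈∁p⇒x∉p (X⊆∁S t∈X) t∈S)

    X̄⊆S∪I─X : ⊤ ─ X ⊆ S ∪ ((∁ S ∪ ⁅ t ⁆) ─ X)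
    X̄⊆S∪I─X {j} j∈X̄ with j ∈? S
    ... | yes j∈S = x∈p∪q⁺ (inj₁ j∈S)
    ... | no j∉S  = x∈p∪q⁺ (inj₂ (x∈p∧x∉q⇒x∈p─q (x∈p∪q⁺ (inj₁ (x∉p⇒x∈∁p j∉S)))
                                                 (x∈p─q⇒x∉q ⊤ X j∈X̄)))

lemma12 : {c ℓ : Level} (F : Field c ℓ) (n : ℕ) (A : Matrix F n) →
          (∀ (i j : Fin n) → i ≢ j → ¬ (Field._≈_ F (A i j) (Field.0# F))) →
          (S : Subset n) → IsCut F A ⊤ S →
          (t : Fin n) → t ∈ S →
          (X : Subset n) → X ⊆ ∁ S →
          IsCut F A (∁ S ∪ ⁅ t ⁆) X →
          IsCut F A ⊤ X
lemma12 F n A offDiagonal≉0 S (4≤n , _ , _ , _ , S-rows , S-cols) t t∈S X X⊆∁S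
        (_ , _ , 2≤∣X∣ , ∣X∣≤∣I∣∸2 , X-rows , X-cols)
  with 0<∣p∣⇒Nonempty X (≤-trans (s≤s z≤n) 2≤∣X∣)
... | i , i∈X =
  4≤n , ⊆⊤ , 2≤∣X∣ , ≤-trans ∣X∣≤∣I∣∸2 (∸-monoˡ-≤ 2 (p⊆q⇒∣p∣≤∣q∣ {p = ∁ S ∪ ⁅ t ⁆} {q = ⊤} ⊆⊤)) ,
  RankAtMostOne-extend F t∈S X⊆∁S i∈X (offDiagonal≉0 i t i≢t) S-cols X-rows ,
  transpose-RankAtMostOne F
    (RankAtMostOne-extend F t∈S X⊆∁S i∈X (offDiagonal≉0 t i t≢i)
      (transpose-RankAtMostOne F S-rows) (transpose-RankAtMostOne F X-cols))
  where
  t∉X : t ∉ X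
  t∉X t∈X = x∈∁p⇒x∉p (X⊆∁S t∈X) t∈S

  i≢t : i ≢ t
  i≢t refl = t∉X i∈X

  t≢i : t ≢ i
  t≢i refl = t∉X i∈X
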